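{- Let $\phi$ be a CLTLB($\mathrm{IPC}^*$) formula. If $\rho\in SV(\phi)^\omega$ satisfies $\rho,0\models_{sym}\phi$, then its weak version satisfies $\rho_w,0\models_{sym}\phi$. Conversely, if $\nu$ is an infinite sequence of weak symbolic valuations of $\phi$ with $\nu,0\models_{sym}\phi$, then every $\rho\in SV(\phi)^\omega$ whose weak version is $\nu$ satisfies $\rho,0\models_{sym}\phi$.
   Context: $\mathrm{IPC}^*$ is the constraint system over $\mathbb{Z}$ with constraints $\xi::=\theta\mid x<y\mid\xi\wedge\xi\mid\neg\xi$, $\theta::=x\equiv_c d\mid x\equiv_c y+d\mid x=y\mid x<d\mid x=d\mid\theta\wedge\theta\mid\neg\theta$ ($c\in\mathbb{N}^+$, $d\in\mathbb{Z}$), usual meaning. $V$ is a finite set of variables; a.t.t.'s $\alpha::=c\mid x\mid\mathrm{X}\alpha\mid\mathrm{Y}\alpha$ with depth $|c|=|x|=0$, $|\mathrm{X}\alpha|=|\alpha|+1$, $|\mathrm{Y}\alpha|=|\alpha|-1$; CLTLB($\mathrm{IPC}^*$) formulae are built from atomic constraints over a.t.t.'s with $\wedge,\neg,\mathbf{X},\mathbf{Y},\mathbf{U},\mathbf{S}$ (standard LTL-with-past semantics, $\mathbf{Y}$ false at position $0$). $\lceil\phi\rceil$ / $\lfloor\phi\rfloor$: max / min of $0$ and depths of a.t.t.'s of $\phi$; $\mathit{terms}(\phi)$: $\mathrm{X}^ix$ ($0\le i\le\lceil\phi\rceil$), $\mathrm{Y}^ix$ ($1\le i\le-\lfloor\phi\rfloor$);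 $\mathit{const}(\phi)$: integers between least and greatest constant of $\phi$. A symbolic valuation is a consistent (terms as distinct fresh variables) and maximal set of constraints over $\mathit{terms}(\phi)\cup\mathit{const}(\phi)$; $SV(\phi)$ their set. For a set $S$ of constraints, $S\models_{sym}\xi$ iff every assignment of the fresh variables satisfying $S$ satisfies $\xi$; for a sequence $\rho$ of such sets, $\rho,i\models_{sym}\psi$ is defined like ordinary satisfaction except that an atomic $\xi$ holds at $i$ iff $\rho(i)\models_{sym}\xi$. Weak valuations: $V$ is partitioned into classes $V_1,\dots,V_h$, the equivalence classes of the equivalence relation generated by: $x$ and $y$ are related if some constraint $R(\mathrm{X}^ix,\mathrm{X}^jy)$ occurs in $\phi$ (with $\mathrm{X}^{ -n}$ meaning $\mathrm{Y}^n$). The weak version $sv_w$ of $sv\in SV(\phi)$ removes from $sv$ every constraint $R(\mathrm{X}^ix,\mathrm{X}^jy)$ with $x\in V_l$, $y\in V_t$, $l\neq t$; weak symbolic valuations of $\phi$ are the weak versions of elements of $SV(\phi)$; the weak version $\rho_w$ of a sequence $\rho$ is taken pointwise. -}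

module Defs where

open import Data.Nat as ℕ using (ℕ; zero; suc; NonZero)
open import Data.Integer as ℤ using (ℤ; +_; -_; _-_; _⊔_; _⊓_)
open import Data.Integer.Divisibility using (_∣_)
open import Data.Fin using (Fin)
open import Data.List using (List; []; _∷_; _++_; map; foldr)
open import Data.List.Membership.Propositional using (_∈_)
open import Data.Product using (Σ; ∃; _×_; _,_)
open import Data.Sum using (_⊎_)
open import Data.Empty using (⊥)
open import Data.Unit using (⊤)
open import Relation.Nullary using (¬_)
open import Relation.Binary.PropositionalEquality using (_≡_)

-- IPC* constraints, generic in the type T of "terms".
-- Since θ is closed under ∧ and ¬, the grammar ξ is exactly the boolean
-- combinations of the atoms below.

data Constr (T : Set) : Set where
  _≡[_]_      : T → (c : ℕ) .{{_ : NonZero c}} → ℤ → Constr T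
  _≡[_]_+_    : T → (c : ℕ) .{{_ : NonZero c}} → T → ℤ → Constr T
  _=ᵛ_        : T → T → Constr T
  _<ᶜ_        : T → ℤ → Constr T
  _=ᶜ_        : T → ℤ → Constr T
  _<ᵛ_        : T → T → Constr T
  _∧ᶜ_        : Constr T → Constr T → Constr T
  ¬ᶜ_         : Constr T → Constr T

mapC : {T U : Set} → (T → U) → Constr T → Constr U
mapC f (t ≡[ c ] d)     = f t ≡[ c ] d
mapC f (t ≡[ c ] u + d) = f t ≡[ c ] f u + d
mapC f (t =ᵛ u)         = f t =ᵛ f u
mapC f (t <ᶜ d)         = f t <ᶜ d
mapC f (t =ᶜ d)         = f t =ᶜ d
mapC f (t <ᵛ u)         = f t <ᵛ f u
mapC f (ξ ∧ᶜ ζ)         = mapC f ξ ∧ᶜ mapC f ζ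
mapC f (¬ᶜ ξ)           = ¬ᶜ mapC f ξ

Sat : {T : Set} → (T → ℤ) → Constr T → Set
Sat ev (t ≡[ c ] d)     = (+ c) ∣ (ev t - d)
Sat ev (t ≡[ c ] u + d) = (+ c) ∣ (ev t - (ev u ℤ.+ d))
Sat ev (t =ᵛ u)         = ev t ≡ ev u
Sat ev (t <ᶜ d)         = ev t ℤ.< d
Sat ev (t =ᶜ d)         = ev t ≡ d
Sat ev (t <ᵛ u)         = ev t ℤ.< ev u
Sat ev (ξ ∧ᶜ ζ)         = Sat ev ξ × Sat ev ζ
Sat ev (¬ᶜ ξ)           = ¬ Sat ev ξ

termsC : {T : Set} → Constr T → List T
termsC (t ≡[ c ] d)     = t ∷ []
termsC (t ≡[ c ] u + d) = t ∷ u ∷ []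
termsC (t =ᵛ u)         = t ∷ u ∷ []
termsC (t <ᶜ d)         = t ∷ []
termsC (t =ᶜ d)         = t ∷ []
termsC (t <ᵛ u)         = t ∷ u ∷ []
termsC (ξ ∧ᶜ ζ)         = termsC ξ ++ termsC ζ
termsC (¬ᶜ ξ)           = termsC ξ

constsC : {T : Set} → Constr T → List ℤ
constsC (t ≡[ c ] d)     = d ∷ []
constsC (t ≡[ c ] u + d) = d ∷ []
constsC (t =ᵛ u)         = []
constsC (t <ᶜ d)         = d ∷ []
constsC (t =ᶜ d)         = d ∷ []
constsC (t <ᵛ u)         = []
constsC (ξ ∧ᶜ ζ)         = constsC ξ ++ constsC ζ
constsC (¬ᶜ ξ)           = constsC ξ

binC : {T : Set} → Constr T → List (T × T)
binC (t ≡[ c ] d)     = []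
binC (t ≡[ c ] u + d) = (t , u) ∷ []
binC (t =ᵛ u)         = (t , u) ∷ []
binC (t <ᶜ d)         = []
binC (t =ᶜ d)         = []
binC (t <ᵛ u)         = (t , u) ∷ []
binC (ξ ∧ᶜ ζ)         = binC ξ ++ binC ζ
binC (¬ᶜ ξ)           = binC ξ

data ATT (n : ℕ) : Set where
  cst : ℤ → ATT n
  var : Fin n → ATT n
  X   : ATT n → ATT n
  Y   : ATT n → ATT n

depth : {n : ℕ} → ATT n → ℤ
depth (cst c) = + 0
depth (var x) = + 0
depth (X α)   = depth α ℤ.+ + 1
depth (Y α)   = depth α - + 1

-- Symbolic terms: a constant, or the fresh variable X^k x (k ∈ ℤ, with
-- X^{-m} meaning Y^m).
data STerm (n : ℕ) : Set where
  scst : ℤ → STerm n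
  svar : Fin n → ℤ → STerm n

-- the symbolic term denoted by an a.t.t. (X^i c is the constant c;
-- an a.t.t. with root variable x denotes X^{|α|} x)
root : {n : ℕ} → ATT n → STerm n
root (cst c) = scst c
root (var x) = svar x (+ 0)
root (X α)   = root α
root (Y α)   = root α

toS : {n : ℕ} → ATT n → STerm n
toS α with root α
... | scst c   = scst c
... | svar x _ = svar x (depth α)

data Form (n : ℕ) : Set where
  atom : Constr (ATT n) → Form n
  _∧ᶠ_ : Form n → Form n → Form n
  ¬ᶠ_  : Form n → Form n
  𝐗    : Form n → Form n
  𝐘    : Form n → Form n
  _𝐔_  : Form n → Form n → Form n
  _𝐒_  : Form n → Form n → Form n

atomsF : {n : ℕ} → Form n → List (Constr (ATT n))
atomsF (atom ξ)  = ξ ∷ []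
atomsF (φ ∧ᶠ ψ)  = atomsF φ ++ atomsF ψ
atomsF (¬ᶠ φ)    = atomsF φ
atomsF (𝐗 φ)     = atomsF φ
atomsF (𝐘 φ)     = atomsF φ
atomsF (φ 𝐔 ψ)   = atomsF φ ++ atomsF ψ
atomsF (φ 𝐒 ψ)   = atomsF φ ++ atomsF ψ

concatMap : {A B : Set} → (A → List B) → List A → List B
concatMap f []       = []
concatMap f (x ∷ xs) = f x ++ concatMap f xs

attsF : {n : ℕ} → Form n → List (ATT n)
attsF φ = concatMap termsC (atomsF φ)

attConst : {n : ℕ} → ATT n → List ℤ
attConst (cst c) = c ∷ []
attConst (var x) = []
attConst (X α)   = attConst α
attConst (Y α)   = attConst α

constsF : {n : ℕ} → Form n → List ℤ
constsF φ = concatMap constsC (atomsF φ) ++ concatMap attConst (attsF φ)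

maxDepth : {n : ℕ} → Form n → ℤ
maxDepth φ = foldr _⊔_ (+ 0) (map depth (attsF φ))

minDepth : {n : ℕ} → Form n → ℤ
minDepth φ = foldr _⊓_ (+ 0) (map depth (attsF φ))

-- c ∈ const(φ): c lies between the least and the greatest constant of φ
InConst : {n : ℕ} → Form n → ℤ → Set
InConst φ c = Σ ℤ λ d → Σ ℤ λ e → d ∈ constsF φ × e ∈ constsF φ × d ℤ.≤ c × c ℤ.≤ e

-- membership in terms(φ) ∪ const(φ)
-- (X^k x with 0 ≤ k ≤ ⌈φ⌉, or Y^m x with 1 ≤ m ≤ -⌊φ⌋, i.e. ⌊φ⌋ ≤ k ≤ ⌈φ⌉)
InTC : {n : ℕ} → Form n → STerm n → Set
InTC φ (scst c)   = InConst φ c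
InTC φ (svar x k) = minDepth φ ℤ.≤ k × k ℤ.≤ maxDepth φ

All : {A : Set} → (A → Set) → List A → Set
All P []       = ⊤
All P (x ∷ xs) = P x × All P xs

OverTC : {n : ℕ} → Form n → Constr (STerm n) → Set
OverTC φ ξ = All (InTC φ) (termsC ξ) × All (InConst φ) (constsC ξ)

CSet : ℕ → Set₁
CSet n = Constr (STerm n) → Set

evalS : {n : ℕ} → (Fin n → ℤ → ℤ) → STerm n → ℤ
evalS a (scst c)   = c
evalS a (svar x k) = a x k

Consistent : {n : ℕ} → CSet n → Set
Consistent S = ∃ λ a → ∀ ζ → S ζ → Sat (evalS a) ζ

IsSV : {n : ℕ} → Form n → CSet n → Set₁
IsSV φ S =
  (∀ ζ → S ζ → OverTC φ ζ) ×
  Consistent S ×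
  (∀ (T : CSet _) → (∀ ζ → T ζ → OverTC φ ζ) → Consistent T →
     (∀ ζ → S ζ → T ζ) → ∀ ζ → T ζ → S ζ)

_⊨sym_ : {n : ℕ} → CSet n → Constr (STerm n) → Set
S ⊨sym ξ = ∀ a → (∀ ζ → S ζ → Sat (evalS a) ζ) → Sat (evalS a) ξ

_,_⊨_ : {n : ℕ} → (ℕ → CSet n) → ℕ → Form n → Set
ρ , i ⊨ atom ξ       = ρ i ⊨sym mapC toS ξ
ρ , i ⊨ (φ ∧ᶠ ψ)     = (ρ , i ⊨ φ) × (ρ , i ⊨ ψ)
ρ , i ⊨ (¬ᶠ φ)       = ¬ (ρ , i ⊨ φ)
ρ , i ⊨ 𝐗 φ          = ρ , suc i ⊨ φ
ρ , zero ⊨ 𝐘 φ       = ⊥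
ρ , suc i ⊨ 𝐘 φ      = ρ , i ⊨ φ
ρ , i ⊨ (φ 𝐔 ψ)      = ∃ λ k → i ℕ.≤ k × (ρ , k ⊨ ψ) × (∀ j → i ℕ.≤ j → j ℕ.< k → ρ , j ⊨ φ)
ρ , i ⊨ (φ 𝐒 ψ)      = ∃ λ k → k ℕ.≤ i × (ρ , k ⊨ ψ) × (∀ j → k ℕ.< j → j ℕ.≤ i → ρ , j ⊨ φ)

data RootVar {n : ℕ} : ATT n → Fin n → Set where
  rv-var : ∀ {x} → RootVar (var x) x
  rv-X   : ∀ {α x} → RootVar α x → RootVar (X α) x
  rv-Y   : ∀ {α x} → RootVar α x → RootVar (Y α) x

Linked : {n : ℕ} → Form n → Fin n → Fin n → Set
Linked φ x y = Σ _ λ ξ → Σ _ λ α → Σ _ λ β →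
  ξ ∈ atomsF φ × (α , β) ∈ binC ξ × RootVar α x × RootVar β y

data Related {n : ℕ} (φ : Form n) : Fin n → Fin n → Set where
  base  : ∀ {x y} → Linked φ x y → Related φ x y
  refl′ : ∀ {x} → Related φ x x
  sym′  : ∀ {x y} → Related φ x y → Related φ y x
  trans′ : ∀ {x y z} → Related φ x y → Related φ y z → Related φ x z

Cross : {n : ℕ} → Form n → Constr (STerm n) → Set
Cross φ ξ = Σ _ λ x → Σ _ λ i → Σ _ λ y → Σ _ λ j →
  (svar x i , svar y j) ∈ binC ξ × ¬ Related φ x y

weak : {n : ℕ} → Form n → CSet n → CSet n
weak φ S ξ = S ξ × ¬ Cross φ ξ

weakSeq : {n : ℕ} → Form n → (ℕ → CSet n) → (ℕ → CSet n)
weakSeq φ ρ i = weak φ (ρ i)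

_≐_ : {n : ℕ} → CSet n → CSet n → Set
S ≐ T = ∀ ξ → (S ξ → T ξ) × (T ξ → S ξ)

IsWeakSV : {n : ℕ} → Form n → CSet n → Set₁
IsWeakSV φ W = Σ (CSet _) λ S → IsSV φ S × (W ≐ weak φ S)

-- A symbolic valuation S is a maximal consistent set of constraints over
-- terms(φ) ∪ const(φ), hence deductively closed: every such constraint that S
-- entails already belongs to S.  Each atom of φ is such a constraint, and it
-- relates only variables of one class, so it survives in the weak version of S.
-- Thus S and its weak version entail the same atoms of φ (the weak version is
-- smaller, so it entails no more), and satisfaction of φ depends on a sequence
-- of constraint sets only through which atoms of φ each set entails.
module Submission where

open import Defs
open import Data.Nat using (ℕ; zero; suc)
open import Data.Fin using (Fin)
open import Data.Integer as ℤ using (ℤ; _⊔_; _⊓_)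
open import Data.Integer.Properties as ℤ using (≤-refl)
open import Data.List using (List; []; _∷_; _++_; map; foldr)
open import Data.List.Properties using (map-++)
open import Data.List.Membership.Propositional using (_∈_)
open import Data.List.Membership.Propositional.Properties using (∈-map⁻; ∈-++⁺ˡ; ∈-++⁺ʳ; ∈-++⁻)
open import Data.List.Relation.Unary.Any using (here; there)
open import Data.Product using (∃; _×_; _,_; proj₁; proj₂)
open import Data.Product.Function.NonDependent.Propositional using (_×-⇔_)
open import Data.Sum using (_⊎_; inj₁; inj₂)
open import Data.Unit using (tt)
open import Function.Bundles using (_⇔_; mk⇔; Equivalence)
open import Function.Construct.Identity using (⇔-id)
open import Function.Construct.Composition using (_⇔-∘_)
open import Function.Related.TypeIsomorphisms using (¬-cong-⇔)
open import Relation.Binary.PropositionalEquality using (_≡_; refl; sym; cong; subst)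
open import Relation.Nullary using (¬_)

open Equivalence using (to; from)

∈-concatMap⁺ : {A B : Set} (f : A → List B) {a : A} {b : B} (as : List A) →
               a ∈ as → b ∈ f a → b ∈ concatMap f as
∈-concatMap⁺ f (a ∷ as) (here refl) b∈fa = ∈-++⁺ˡ b∈fa
∈-concatMap⁺ f (a ∷ as) (there a∈as) b∈fa = ∈-++⁺ʳ (f a) (∈-concatMap⁺ f as a∈as b∈fa)

All-intro : {A : Set} {P : A → Set} (xs : List A) → (∀ x → x ∈ xs → P x) → All P xs
All-intro []       h = tt
All-intro (x ∷ xs) h = h x (here refl) , All-intro xs (λ y y∈xs → h y (there y∈xs))

≤-foldr-⊔ : {A : Set} (f : A → ℤ) {a : A} (as : List A) →
            a ∈ as → f a ℤ.≤ foldr _⊔_ (ℤ.+ 0) (map f as)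
≤-foldr-⊔ f (a ∷ as) (here refl)  = ℤ.i≤i⊔j (f a) _
≤-foldr-⊔ f (b ∷ as) (there a∈as) = ℤ.i≤j⇒i≤k⊔j (f b) (≤-foldr-⊔ f as a∈as)

foldr-⊓-≤ : {A : Set} (f : A → ℤ) {a : A} (as : List A) →
            a ∈ as → foldr _⊓_ (ℤ.+ 0) (map f as) ℤ.≤ f a
foldr-⊓-≤ f (a ∷ as) (here refl)  = ℤ.i⊓j≤i (f a) _
foldr-⊓-≤ f (b ∷ as) (there a∈as) = ℤ.i≤j⇒k⊓i≤j (f b) (foldr-⊓-≤ f as a∈as)

termsC-mapC : {T U : Set} (f : T → U) (ξ : Constr T) → termsC (mapC f ξ) ≡ map f (termsC ξ)
termsC-mapC f (t ≡[ c ] d)     = refl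
termsC-mapC f (t ≡[ c ] u + d) = refl
termsC-mapC f (t =ᵛ u)         = refl
termsC-mapC f (t <ᶜ d)         = refl
termsC-mapC f (t =ᶜ d)         = refl
termsC-mapC f (t <ᵛ u)         = refl
termsC-mapC f (ξ ∧ᶜ ζ) rewrite termsC-mapC f ξ | termsC-mapC f ζ = sym (map-++ f (termsC ξ) (termsC ζ))
termsC-mapC f (¬ᶜ ξ)           = termsC-mapC f ξ

constsC-mapC : {T U : Set} (f : T → U) (ξ : Constr T) → constsC (mapC f ξ) ≡ constsC ξ
constsC-mapC f (t ≡[ c ] d)     = refl
constsC-mapC f (t ≡[ c ] u + d) = refl
constsC-mapC f (t =ᵛ u)         = refl
constsC-mapC f (t <ᶜ d)         = refl
constsC-mapC f (t =ᶜ d)         = refl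
constsC-mapC f (t <ᵛ u)         = refl
constsC-mapC f (ξ ∧ᶜ ζ) rewrite constsC-mapC f ξ | constsC-mapC f ζ = refl
constsC-mapC f (¬ᶜ ξ)           = constsC-mapC f ξ

∈-binC-mapC⁻ : {T U : Set} (f : T → U) (ξ : Constr T) {p : U × U} → p ∈ binC (mapC f ξ) →
               ∃ λ ((a , b) : T × T) → (a , b) ∈ binC ξ × p ≡ (f a , f b)
∈-binC-mapC⁻ f (t ≡[ c ] u + d) (here refl) = _ , here refl , refl
∈-binC-mapC⁻ f (t =ᵛ u)         (here refl) = _ , here refl , refl
∈-binC-mapC⁻ f (t <ᵛ u)         (here refl) = _ , here refl , refl
∈-binC-mapC⁻ f (ξ ∧ᶜ ζ) p∈ with ∈-++⁻ (binC (mapC f ξ)) p∈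
... | inj₁ p∈ξ = let ab , ab∈ξ , eq = ∈-binC-mapC⁻ f ξ p∈ξ in ab , ∈-++⁺ˡ ab∈ξ , eq
... | inj₂ p∈ζ = let ab , ab∈ζ , eq = ∈-binC-mapC⁻ f ζ p∈ζ in ab , ∈-++⁺ʳ (binC ξ) ab∈ζ , eq
∈-binC-mapC⁻ f (¬ᶜ ξ) p∈ = ∈-binC-mapC⁻ f ξ p∈

module _ {n : ℕ} where

  root-scst : (α : ATT n) {c : ℤ} → root α ≡ scst c → c ∈ attConst α
  root-scst (cst c) refl = here refl
  root-scst (X α) eq = root-scst α eq
  root-scst (Y α) eq = root-scst α eq

  root-svar : (α : ATT n) {x : Fin n} {k : ℤ} → root α ≡ svar x k → RootVar α x
  root-svar (var x) refl = rv-var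
  root-svar (X α) eq = rv-X (root-svar α eq)
  root-svar (Y α) eq = rv-Y (root-svar α eq)

  toS-view : (α : ATT n) →
             (∃ λ c → toS α ≡ scst c × c ∈ attConst α) ⊎
             (∃ λ x → toS α ≡ svar x (depth α) × RootVar α x)
  toS-view α with root α in eq
  ... | scst c   = inj₁ (c , refl , root-scst α eq)
  ... | svar x _ = inj₂ (x , refl , root-svar α eq)

  toS-svar : (α : ATT n) {x : Fin n} {k : ℤ} → toS α ≡ svar x k → RootVar α x
  toS-svar α eq with root α in r
  toS-svar α ()   | scst c
  toS-svar α refl | svar x _ = root-svar α r

module _ {n : ℕ} (φ : Form n) where

  ∈constsF⇒InConst : {c : ℤ} → c ∈ constsF φ → InConst φ c
  ∈constsF⇒InConst {c} c∈ = c , c , c∈ , c∈ , ≤-refl , ≤-refl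

  ∈attsF⇒InTC-toS : {α : ATT n} → α ∈ attsF φ → InTC φ (toS α)
  ∈attsF⇒InTC-toS {α} α∈ with toS-view α
  ... | inj₁ (c , eq , c∈α) rewrite eq =
    ∈constsF⇒InConst (∈-++⁺ʳ (concatMap constsC (atomsF φ)) (∈-concatMap⁺ attConst (attsF φ) α∈ c∈α))
  ... | inj₂ (_ , eq , _) rewrite eq = foldr-⊓-≤ depth (attsF φ) α∈ , ≤-foldr-⊔ depth (attsF φ) α∈

  atom-OverTC : {ξ : Constr (ATT n)} → ξ ∈ atomsF φ → OverTC φ (mapC toS ξ)
  atom-OverTC {ξ} ξ∈ =
      subst (All (InTC φ)) (sym (termsC-mapC toS ξ)) (All-intro _ InTC-toS)
    , subst (All (InConst φ)) (sym (constsC-mapC toS ξ)) (All-intro _ λ d d∈ξ →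
        ∈constsF⇒InConst (∈-++⁺ˡ (∈-concatMap⁺ constsC (atomsF φ) ξ∈ d∈ξ)))
    where
    InTC-toS : ∀ t → t ∈ map toS (termsC ξ) → InTC φ t
    InTC-toS t t∈ with ∈-map⁻ toS t∈
    ... | α , α∈ξ , refl = ∈attsF⇒InTC-toS (∈-concatMap⁺ termsC (atomsF φ) ξ∈ α∈ξ)

  atom-¬Cross : {ξ : Constr (ATT n)} → ξ ∈ atomsF φ → ¬ Cross φ (mapC toS ξ)
  atom-¬Cross {ξ} ξ∈ (x , i , y , j , p∈ , x≁y) with ∈-binC-mapC⁻ toS ξ p∈
  ... | (α , β) , αβ∈ξ , eq =
    x≁y (base (ξ , α , β , ξ∈ , αβ∈ξ , toS-svar α (sym (cong proj₁ eq)) , toS-svar β (sym (cong proj₂ eq))))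

module _ {n : ℕ} where

  ⊨sym-mono : {S T : CSet n} → (∀ ζ → S ζ → T ζ) → {ξ : Constr (STerm n)} → S ⊨sym ξ → T ⊨sym ξ
  ⊨sym-mono S⊆T S⊨ξ a a⊨T = S⊨ξ a (λ ζ ζ∈S → a⊨T ζ (S⊆T ζ ζ∈S))

  ⊨sym-cong : {S T : CSet n} → S ≐ T → {ξ : Constr (STerm n)} → (S ⊨sym ξ) ⇔ (T ⊨sym ξ)
  ⊨sym-cong S≐T = mk⇔ (⊨sym-mono (λ ζ → proj₁ (S≐T ζ))) (⊨sym-mono (λ ζ → proj₂ (S≐T ζ)))

  IsSV⇒⊨sym-closed : (φ : Form n) {S : CSet n} → IsSV φ S →
                     {ξ : Constr (STerm n)} → OverTC φ ξ → S ⊨sym ξ → S ξ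
  IsSV⇒⊨sym-closed φ {S} (S-over , (a , a⊨S) , S-maximal) {ξ} ξ-over S⊨ξ =
    S-maximal S+ξ S+ξ-over (a , a⊨S+ξ) (λ _ → inj₁) ξ (inj₂ refl)
    where
    S+ξ : CSet n
    S+ξ ζ = S ζ ⊎ ζ ≡ ξ
    S+ξ-over : ∀ ζ → S+ξ ζ → OverTC φ ζ
    S+ξ-over ζ (inj₁ ζ∈S) = S-over ζ ζ∈S
    S+ξ-over ζ (inj₂ refl) = ξ-over
    a⊨S+ξ : ∀ ζ → S+ξ ζ → Sat (evalS a) ζ
    a⊨S+ξ ζ (inj₁ ζ∈S) = a⊨S ζ ζ∈S
    a⊨S+ξ ζ (inj₂ refl) = S⊨ξ a a⊨S

  IsSV⇒weak-⊨sym-atom : (φ : Form n) {S : CSet n} → IsSV φ S → {ξ : Constr (ATT n)} → ξ ∈ atomsF φ →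
                        (S ⊨sym mapC toS ξ) ⇔ (weak φ S ⊨sym mapC toS ξ)
  IsSV⇒weak-⊨sym-atom φ S-sv ξ∈ = mk⇔
    (λ S⊨ξ a a⊨W → a⊨W _ (IsSV⇒⊨sym-closed φ S-sv (atom-OverTC φ ξ∈) S⊨ξ , atom-¬Cross φ ξ∈))
    (⊨sym-mono (λ _ → proj₁))

  AgreeOn : List (Constr (ATT n)) → (ℕ → CSet n) → (ℕ → CSet n) → Set
  AgreeOn ξs ρ σ = ∀ {ξ} → ξ ∈ ξs → ∀ i → (ρ i ⊨sym mapC toS ξ) ⇔ (σ i ⊨sym mapC toS ξ)

  AgreeOn-++ˡ : ∀ {ξs ζs ρ σ} → AgreeOn (ξs ++ ζs) ρ σ → AgreeOn ξs ρ σ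
  AgreeOn-++ˡ agree ξ∈ = agree (∈-++⁺ˡ ξ∈)

  AgreeOn-++ʳ : ∀ ξs {ζs ρ σ} → AgreeOn (ξs ++ ζs) ρ σ → AgreeOn ζs ρ σ
  AgreeOn-++ʳ ξs agree ζ∈ = agree (∈-++⁺ʳ ξs ζ∈)

∃-bounded-cong : {C : ℕ → Set} {D E : ℕ → ℕ → Set} {P P′ Q Q′ : ℕ → Set} →
                 (∀ k → P k ⇔ P′ k) → (∀ j → Q j ⇔ Q′ j) →
                 (∃ λ k → C k × P k × (∀ j → D k j → E k j → Q j)) ⇔
                 (∃ λ k → C k × P′ k × (∀ j → D k j → E k j → Q′ j))
∃-bounded-cong P⇔P′ Q⇔Q′ = mk⇔
  (λ (k , c , p , q) → k , c , to (P⇔P′ k) p , λ j d e → to (Q⇔Q′ j) (q j d e))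
  (λ (k , c , p , q) → k , c , from (P⇔P′ k) p , λ j d e → from (Q⇔Q′ j) (q j d e))

⊨-cong : {n : ℕ} (ψ : Form n) {ρ σ : ℕ → CSet n} → AgreeOn (atomsF ψ) ρ σ →
         ∀ i → (ρ , i ⊨ ψ) ⇔ (σ , i ⊨ ψ)
⊨-cong (atom ξ) agree i = agree (here refl) i
⊨-cong (ψ ∧ᶠ χ) agree i = ⊨-cong ψ (AgreeOn-++ˡ agree) i ×-⇔ ⊨-cong χ (AgreeOn-++ʳ (atomsF ψ) agree) i
⊨-cong (¬ᶠ ψ)   agree i = ¬-cong-⇔ (⊨-cong ψ agree i)
⊨-cong (𝐗 ψ)    agree i = ⊨-cong ψ agree (suc i)
⊨-cong (𝐘 ψ)    agree zero = ⇔-id _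
⊨-cong (𝐘 ψ)    agree (suc i) = ⊨-cong ψ agree i
⊨-cong (ψ 𝐔 χ)  agree i =
  ∃-bounded-cong (⊨-cong χ (AgreeOn-++ʳ (atomsF ψ) agree)) (⊨-cong ψ (AgreeOn-++ˡ agree))
⊨-cong (ψ 𝐒 χ)  agree i =
  ∃-bounded-cong (⊨-cong χ (AgreeOn-++ʳ (atomsF ψ) agree)) (⊨-cong ψ (AgreeOn-++ˡ agree))

lemma7 : {n : ℕ} (φ : Form n) →
    (∀ (ρ : ℕ → CSet n) → (∀ i → IsSV φ (ρ i)) →
       ρ , 0 ⊨ φ → weakSeq φ ρ , 0 ⊨ φ)
    ×
    (∀ (ν : ℕ → CSet n) → (∀ i → IsWeakSV φ (ν i)) → ν , 0 ⊨ φ →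
       ∀ (ρ : ℕ → CSet n) → (∀ i → IsSV φ (ρ i)) →
       (∀ i → weakSeq φ ρ i ≐ ν i) → ρ , 0 ⊨ φ)
lemma7 φ =
    (λ ρ ρ-sv → to (⊨-cong φ (agree-weak ρ-sv) 0))
  , (λ ν _ ν⊨φ ρ ρ-sv ρw≐ν →
       from (⊨-cong φ (λ ξ∈ i → ⊨sym-cong (ρw≐ν i) ⇔-∘ agree-weak ρ-sv ξ∈ i) 0) ν⊨φ)
  where
  agree-weak : ∀ {ρ} → (∀ i → IsSV φ (ρ i)) → AgreeOn (atomsF φ) ρ (weakSeq φ ρ)
  agree-weak ρ-sv ξ∈ i = IsSV⇒weak-⊨sym-atom φ (ρ-sv i) ξ∈
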